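{- Let $S_n$ be the Sierpiński gasket graph with $n\geq 3$. Then $SSPC_{2U}(S_n)\leq 6\cdot 3^{n-3}$.
   Context: The Sierpiński gasket graphs are defined recursively: $S_1=K_3$, whose three vertices are its extreme vertices; $S_{n+1}$ is obtained from three copies $A,B,C$ of $S_n$ with extreme vertices $a_1,a_2,a_3$, $b_1,b_2,b_3$, $c_1,c_2,c_3$ by identifying $a_2$ with $b_1$, $a_3$ with $c_1$, and $b_3$ with $c_2$; the extreme vertices of $S_{n+1}$ are $a_1,b_2,c_3$. For a graph $G$ with distance $d$, a set $S\subseteq V(G)$ is a $2$-strong shortest path union cover if one can choose, for each $u\in S$ and each $v\in V(G)$ with $d(u,v)\leq 2$, a single shortest $u$–$v$ path $P(u,v)$ such that the union of the edge sets of all chosen paths equals $E(G)$; $SSPC_{2U}(G)$ is the minimum cardinality of such a set. -}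

module Defs where

open import Data.Nat using (ℕ; zero; suc; _+_; _*_; _∸_; _≤_)
open import Agda.Builtin.Nat using (_==_)
open import Data.Bool using (Bool; true; false; if_then_else_; not; _∧_)
open import Data.List using (List; []; _∷_; _++_; map; filter; length; filterᵇ)
open import Data.List.Membership.Propositional using (_∈_)
open import Data.Product using (_×_; _,_; Σ; ∃; ∃-syntax; Σ-syntax)
open import Data.Sum using (_⊎_)
open import Relation.Binary.PropositionalEquality using (_≡_)

record Gasket : Set where
  constructor gasket
  field
    bound : ℕ                -- all vertex labels are < bound
    verts : List ℕ           -- vertex set (distinct labels)
    edges : List (ℕ × ℕ)     -- edge set (each edge listed once)
    ex₁ ex₂ ex₃ : ℕ

open Gasket public

K₃ : Gasket
K₃ = gasket 3 (0 ∷ 1 ∷ 2 ∷ []) ((0 , 1) ∷ (1 , 2) ∷ (0 , 2) ∷ []) 0 1 2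

-- Copy A keeps the labels of G; copy B is shifted by M = bound G,
-- copy C by 2M, and the identifications a₂ = b₁, a₃ = c₁, b₃ = c₂
-- are realised by the relabelling maps below.
step : Gasket → Gasket
step G = gasket (3 * M) vs es (ex₁ G) (M + ex₂ G) (2 * M + ex₃ G)
  where
    M = bound G
    fA : ℕ → ℕ
    fA v = v
    fB : ℕ → ℕ
    fB v = if v == ex₁ G then ex₂ G else M + v
    fC : ℕ → ℕ
    fC v = if v == ex₁ G then ex₃ G
           else (if v == ex₂ G then fB (ex₃ G) else 2 * M + v)
    mapE : (ℕ → ℕ) → List (ℕ × ℕ) → List (ℕ × ℕ)
    mapE f = map (λ { (x , y) → (f x , f y) })
    vs : List ℕ
    vs = verts G
         ++ map fB (filterᵇ (λ v → not (v == ex₁ G)) (verts G))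
         ++ map fC (filterᵇ (λ v → not (v == ex₁ G) ∧ not (v == ex₂ G)) (verts G))
    es : List (ℕ × ℕ)
    es = mapE fA (edges G) ++ mapE fB (edges G) ++ mapE fC (edges G)

-- Sier k is the Sierpiński gasket graph S_{k+1}
Sier : ℕ → Gasket
Sier zero = K₃
Sier (suc k) = step (Sier k)

-- S n is the Sierpiński gasket graph S_n (for n ≥ 1)
S : ℕ → Gasket
S n = Sier (n ∸ 1)

Adj : Gasket → ℕ → ℕ → Set
Adj G x y = ((x , y) ∈ edges G) ⊎ ((y , x) ∈ edges G)

data IsWalk (G : Gasket) : ℕ → ℕ → List ℕ → Set where
  single : ∀ {v} → v ∈ verts G → IsWalk G v v (v ∷ [])
  cons   : ∀ {u w v ws} → Adj G u w → IsWalk G w v ws → IsWalk G u v (u ∷ ws)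

len : List ℕ → ℕ
len p = length p ∸ 1

IsShortest : Gasket → ℕ → ℕ → List ℕ → Set
IsShortest G u v p = IsWalk G u v p × (∀ q → IsWalk G u v q → len p ≤ len q)

DistLe : Gasket → ℕ → ℕ → ℕ → Set
DistLe G u v k = ∃[ q ] (IsWalk G u v q × len q ≤ k)

data Consec (x y : ℕ) : List ℕ → Set where
  here  : ∀ {l} → Consec x y (x ∷ y ∷ l)
  there : ∀ {z l} → Consec x y l → Consec x y (z ∷ l)

EdgeOf : ℕ → ℕ → List ℕ → Set
EdgeOf x y p = Consec x y p ⊎ Consec y x p

-- S is a 2-strong shortest path union cover of G: there is a choice
-- P u v of a shortest u–v path for every u ∈ S and every vertex v with
-- d(u,v) ≤ 2, whose edge sets together cover E(G).  (The edges of the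
-- chosen paths are automatically edges of G.)
Is2SSPUCover : Gasket → List ℕ → Set
Is2SSPUCover G Sv =
  (∀ u → u ∈ Sv → u ∈ verts G) ×
  Σ[ P ∈ (ℕ → ℕ → List ℕ) ] ( (∀ u v → u ∈ Sv → v ∈ verts G → DistLe G u v 2 → IsShortest G u v (P u v))
         × (∀ x y → (x , y) ∈ edges G →
              ∃[ u ] ∃[ v ] (u ∈ Sv × v ∈ verts G × DistLe G u v 2 × EdgeOf x y (P u v))) )

SSPC2U≤ : Gasket → ℕ → Set
SSPC2U≤ G k = ∃[ Sv ] (Is2SSPUCover G Sv × length Sv ≤ k)

-- S₃ has six centres, none of them extreme, and geodesics of length at most 2 issuing
-- from them whose edges cover S₃; this is checked by computation. S_{n+1} consists of
-- three copies of S_n, each an induced subgraph meeting the others only in extreme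
-- vertices, so a geodesic of length at most 2 inside a copy remains one in S_{n+1}, and
-- the edge sets of the copies partition the edges of S_{n+1}. Placing such a cover of S_n
-- in every copy therefore covers S_{n+1} and triples its size, which gives 6 · 3^(n-3).

module Submission where

open import Defs
open import Data.Nat using (ℕ; _≤_; _*_; _^_; _∸_)
open import Data.Nat using (zero; suc; _+_; _<_; _≮_; z≤n; s≤s; _<?_)
open import Data.Nat.Properties
open import Agda.Builtin.Nat using (_==_)
open import Data.Bool using (Bool; true; false; if_then_else_; not; _∧_; T; T?)
open import Data.List using (List; []; _∷_; _++_; map; filterᵇ; length)
open import Data.List.Properties using (length-++; length-map)
open import Data.List.Membership.Propositional using (_∈_)
open import Data.List.Membership.Propositional.Properties
  using (∈-++⁺ˡ; ∈-++⁺ʳ; ∈-++⁻; ∈-map⁺; ∈-map⁻; ∈-filter⁺; ∈-filter⁻)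
import Data.List.Membership.DecPropositional as DecMembership
open import Data.List.Relation.Unary.Any as Any using (here; there; any?; satisfied)
open import Data.List.Relation.Unary.All as All using (All; all?)
open import Data.Product using (_×_; _,_; proj₁; proj₂; ∃-syntax)
open import Data.Product.Properties using (≡-dec)
open import Data.Sum using (inj₁; inj₂)
open import Data.Empty using (⊥; ⊥-elim)
open import Data.Unit using (tt)
open import Function using (_∘_; flip)
open import Relation.Nullary using (¬_; Dec; yes; no)
open import Relation.Nullary.Decidable
  using (_×-dec_; _⊎-dec_; ¬?; map′; toWitness; dec-true; dec-false)
open import Relation.Binary.PropositionalEquality

open DecMembership _≟_ using (_∈?_)
open DecMembership (≡-dec _≟_ _≟_) using () renaming (_∈?_ to _∈ₑ?_)

adj? : ∀ G x y → Dec (Adj G x y)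
adj? G x y = ((x , y) ∈ₑ? edges G) ⊎-dec ((y , x) ∈ₑ? edges G)

data Geodesic≤2 (G : Gasket) : ℕ → ℕ → List ℕ → Set where
  zeroSteps : ∀ {v} → v ∈ verts G → Geodesic≤2 G v v (v ∷ [])
  oneStep   : ∀ {u v} → u ∈ verts G → v ∈ verts G → ¬ u ≡ v → Adj G u v →
              Geodesic≤2 G u v (u ∷ v ∷ [])
  twoSteps  : ∀ {u w v} → u ∈ verts G → v ∈ verts G → ¬ u ≡ v → ¬ Adj G u v →
              Adj G u w → Adj G w v → Geodesic≤2 G u v (u ∷ w ∷ v ∷ [])

geodesic≤2? : ∀ G u v p → Dec (Geodesic≤2 G u v p)
geodesic≤2? G u v [] = no λ ()
geodesic≤2? G u v (a ∷ []) = map′ to from ((a ≟ u) ×-dec (a ≟ v) ×-dec (v ∈? verts G))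
  where
    to : (a ≡ u) × (a ≡ v) × v ∈ verts G → Geodesic≤2 G u v (a ∷ [])
    to (refl , refl , v∈) = zeroSteps v∈
    from : Geodesic≤2 G u v (a ∷ []) → (a ≡ u) × (a ≡ v) × v ∈ verts G
    from (zeroSteps v∈) = refl , refl , v∈
geodesic≤2? G u v (a ∷ b ∷ []) =
  map′ to from ((a ≟ u) ×-dec (b ≟ v) ×-dec (u ∈? verts G) ×-dec (v ∈? verts G)
                ×-dec ¬? (u ≟ v) ×-dec adj? G u v)
  where
    to : _ → Geodesic≤2 G u v (a ∷ b ∷ [])
    to (refl , refl , u∈ , v∈ , u≢v , uv) = oneStep u∈ v∈ u≢v uv
    from : Geodesic≤2 G u v (a ∷ b ∷ []) → _
    from (oneStep u∈ v∈ u≢v uv) = refl , refl , u∈ , v∈ , u≢v , uv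
geodesic≤2? G u v (a ∷ w ∷ b ∷ []) =
  map′ to from ((a ≟ u) ×-dec (b ≟ v) ×-dec (u ∈? verts G) ×-dec (v ∈? verts G)
                ×-dec ¬? (u ≟ v) ×-dec ¬? (adj? G u v) ×-dec adj? G u w ×-dec adj? G w v)
  where
    to : _ → Geodesic≤2 G u v (a ∷ w ∷ b ∷ [])
    to (refl , refl , u∈ , v∈ , u≢v , ¬uv , uw , wv) = twoSteps u∈ v∈ u≢v ¬uv uw wv
    from : Geodesic≤2 G u v (a ∷ w ∷ b ∷ []) → _
    from (twoSteps u∈ v∈ u≢v ¬uv uw wv) = refl , refl , u∈ , v∈ , u≢v , ¬uv , uw , wv
geodesic≤2? G u v (_ ∷ _ ∷ _ ∷ _ ∷ _) = no λ ()

Geodesic≤2⇒IsWalk : ∀ {G u v p} → Geodesic≤2 G u v p → IsWalk G u v p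
Geodesic≤2⇒IsWalk (zeroSteps v∈) = single v∈
Geodesic≤2⇒IsWalk (oneStep _ v∈ _ uv) = cons uv (single v∈)
Geodesic≤2⇒IsWalk (twoSteps _ v∈ _ _ uw wv) = cons uw (cons wv (single v∈))

Geodesic≤2⇒DistLe : ∀ {G u v p} → Geodesic≤2 G u v p → DistLe G u v 2
Geodesic≤2⇒DistLe sp = _ , Geodesic≤2⇒IsWalk sp , len≤2 sp
  where
    len≤2 : ∀ {G u v p} → Geodesic≤2 G u v p → len p ≤ 2
    len≤2 (zeroSteps _) = z≤n
    len≤2 (oneStep _ _ _ _) = s≤s z≤n
    len≤2 (twoSteps _ _ _ _ _ _) = s≤s (s≤s z≤n)

Geodesic≤2⇒IsShortest : ∀ {G u v p} → Geodesic≤2 G u v p → IsShortest G u v p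
Geodesic≤2⇒IsShortest sp = Geodesic≤2⇒IsWalk sp , minimal sp
  where
    minimal : ∀ {G u v p} → Geodesic≤2 G u v p → ∀ q → IsWalk G u v q → len p ≤ len q
    minimal (zeroSteps _) _ _ = z≤n
    minimal (oneStep _ _ u≢v _) _ (single _) = ⊥-elim (u≢v refl)
    minimal (oneStep _ _ _ _) _ (cons _ (single _)) = s≤s z≤n
    minimal (oneStep _ _ _ _) _ (cons _ (cons _ _)) = s≤s z≤n
    minimal (twoSteps _ _ u≢v _ _ _) _ (single _) = ⊥-elim (u≢v refl)
    minimal (twoSteps _ _ _ ¬uv _ _) _ (cons uv (single _)) = ⊥-elim (¬uv uv)
    minimal (twoSteps _ _ _ _ _ _) _ (cons _ (cons _ (single _))) = s≤s (s≤s z≤n)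
    minimal (twoSteps _ _ _ _ _ _) _ (cons _ (cons _ (cons _ _))) = s≤s (s≤s z≤n)

Geodesic≤2⇒target∈ : ∀ {G u v p} → Geodesic≤2 G u v p → v ∈ verts G
Geodesic≤2⇒target∈ (zeroSteps v∈) = v∈
Geodesic≤2⇒target∈ (oneStep _ v∈ _ _) = v∈
Geodesic≤2⇒target∈ (twoSteps _ v∈ _ _ _ _) = v∈

edgeEnds : Gasket → List ℕ
edgeEnds G = map proj₁ (edges G) ++ map proj₂ (edges G)

Adj⇒∈edgeEnds : ∀ G {u w} → Adj G u w → w ∈ edgeEnds G
Adj⇒∈edgeEnds G (inj₁ uw∈) = ∈-++⁺ʳ (map proj₁ (edges G)) (∈-map⁺ proj₂ uw∈)
Adj⇒∈edgeEnds G (inj₂ wu∈) = ∈-++⁺ˡ (∈-map⁺ proj₁ wu∈)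

-- Middle vertices are searched among edge endpoints: Adj G u w does not force w ∈ verts G.
canonicalPath : Gasket → ℕ → ℕ → List ℕ
canonicalPath G u v with u ≟ v
... | yes _ = u ∷ []
... | no _ with adj? G u v
... | yes _ = u ∷ v ∷ []
... | no _ with any? (λ w → adj? G u w ×-dec adj? G w v) (edgeEnds G)
... | yes found = u ∷ proj₁ (satisfied found) ∷ v ∷ []
... | no _ = u ∷ []

canonicalPath-geodesic : ∀ G u v → u ∈ verts G → v ∈ verts G → DistLe G u v 2 →
                      Geodesic≤2 G u v (canonicalPath G u v)
canonicalPath-geodesic G u v u∈ v∈ d with u ≟ v
... | yes refl = zeroSteps v∈
... | no u≢v with adj? G u v
... | yes uv = oneStep u∈ v∈ u≢v uv
... | no ¬uv with any? (λ w → adj? G u w ×-dec adj? G w v) (edgeEnds G)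
... | yes found = let (_ , uw , wv) = satisfied found in twoSteps u∈ v∈ u≢v ¬uv uw wv
... | no noMiddle = ⊥-elim (unreachable d)
  where
    unreachable : DistLe G u v 2 → ⊥
    unreachable (_ , single _ , _) = u≢v refl
    unreachable (_ , cons uv (single _) , _) = ¬uv uv
    unreachable (_ , cons uw (cons wv (single _)) , _) =
      noMiddle (Any.map (λ { refl → uw , wv }) (Adj⇒∈edgeEnds G uw))
    unreachable (_ , cons _ (cons _ (cons _ (single _))) , s≤s (s≤s ()))
    unreachable (_ , cons _ (cons _ (cons _ (cons _ _))) , s≤s (s≤s ()))

orCanonical : Gasket → (ℕ → ℕ → List ℕ) → ℕ → ℕ → List ℕ
orCanonical G P u v with geodesic≤2? G u v (P u v)
... | yes _ = P u v
... | no _ = canonicalPath G u v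

orCanonical-geodesic : ∀ G P u v → u ∈ verts G → v ∈ verts G → DistLe G u v 2 →
                    Geodesic≤2 G u v (orCanonical G P u v)
orCanonical-geodesic G P u v u∈ v∈ d with geodesic≤2? G u v (P u v)
... | yes sp = sp
... | no _ = canonicalPath-geodesic G u v u∈ v∈ d

orCanonical-≡ : ∀ {G} P {u v} → Geodesic≤2 G u v (P u v) → orCanonical G P u v ≡ P u v
orCanonical-≡ {G} P {u} {v} sp with geodesic≤2? G u v (P u v)
... | yes _ = refl
... | no ¬sp = ⊥-elim (¬sp sp)

record LocalCover (G : Gasket) (Sv : List ℕ) (P : ℕ → ℕ → List ℕ) : Set where
  field
    centres∈ : ∀ {u} → u ∈ Sv → u ∈ verts G
    covers   : ∀ {x y} → (x , y) ∈ edges G →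
               ∃[ u ] ∃[ v ] (u ∈ Sv × Geodesic≤2 G u v (P u v) × EdgeOf x y (P u v))

LocalCover⇒Is2SSPUCover : ∀ {G Sv P} → LocalCover G Sv P → Is2SSPUCover G Sv
LocalCover⇒Is2SSPUCover {G} {Sv} {P} lc =
  (λ _ → centres∈) , orCanonical G P , shortest , covered
  where
    open LocalCover lc
    shortest : ∀ u v → u ∈ Sv → v ∈ verts G → DistLe G u v 2 →
               IsShortest G u v (orCanonical G P u v)
    shortest u v u∈ v∈ d =
      Geodesic≤2⇒IsShortest (orCanonical-geodesic G P u v (centres∈ u∈) v∈ d)
    covered : ∀ x y → (x , y) ∈ edges G → ∃[ u ] ∃[ v ]
              (u ∈ Sv × v ∈ verts G × DistLe G u v 2 × EdgeOf x y (orCanonical G P u v))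
    covered x y xy∈ with covers xy∈
    ... | u , v , u∈ , sp , onPath =
      u , v , u∈ , Geodesic≤2⇒target∈ sp , Geodesic≤2⇒DistLe sp ,
      subst (EdgeOf x y) (sym (orCanonical-≡ P sp)) onPath

Consec-map : ∀ (f : ℕ → ℕ) {x y p} → Consec x y p → Consec (f x) (f y) (map f p)
Consec-map f here = here
Consec-map f (there c) = there (Consec-map f c)

EdgeOf-map : ∀ (f : ℕ → ℕ) {x y p} → EdgeOf x y p → EdgeOf (f x) (f y) (map f p)
EdgeOf-map f (inj₁ c) = inj₁ (Consec-map f c)
EdgeOf-map f (inj₂ c) = inj₂ (Consec-map f c)

consec? : ∀ x y p → Dec (Consec x y p)
consec? x y [] = no λ ()
consec? x y (a ∷ []) = no λ { (there ()) }
consec? x y (a ∷ b ∷ l) = map′ to from (((x ≟ a) ×-dec (y ≟ b)) ⊎-dec consec? x y (b ∷ l))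
  where
    to : _ → Consec x y (a ∷ b ∷ l)
    to (inj₁ (refl , refl)) = here
    to (inj₂ c) = there c
    from : Consec x y (a ∷ b ∷ l) → _
    from here = inj₁ (refl , refl)
    from (there c) = inj₂ c

edgeOf? : ∀ x y p → Dec (EdgeOf x y p)
edgeOf? x y p = consec? x y p ⊎-dec consec? y x p

==-refl : ∀ n → (n == n) ≡ true
==-refl n = dec-true (n ≟ n) refl

≢⇒==-false : ∀ {m n} → m ≢ n → (m == n) ≡ false
≢⇒==-false {m} {n} = dec-false (m ≟ n)

<M⇒≢M+ : ∀ {a M b} → a < M → a ≢ M + b
<M⇒≢M+ {M = M} {b} a<M refl = m+n≮m M b a<M

2*M+x≡M+[M+x] : ∀ M x → 2 * M + x ≡ M + (M + x)
2*M+x≡M+[M+x] M x = trans (cong (λ z → (M + z) + x) (+-identityʳ M)) (+-assoc M M x)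

record WellLabelled (G : Gasket) : Set where
  field
    vertex<bound : ∀ {v} → v ∈ verts G → v < bound G
    edge<bound   : ∀ {x y} → (x , y) ∈ edges G → x < bound G × y < bound G
    ex₁∈ : ex₁ G ∈ verts G
    ex₂∈ : ex₂ G ∈ verts G
    ex₃∈ : ex₃ G ∈ verts G
    ex₁≢ex₂ : ex₁ G ≢ ex₂ G
    ex₁≢ex₃ : ex₁ G ≢ ex₃ G
    ex₂≢ex₃ : ex₂ G ≢ ex₃ G

data Copy : Set where
  A B C : Copy

_≟ᶜ_ : (c d : Copy) → Dec (c ≡ d)
A ≟ᶜ A = yes refl
A ≟ᶜ B = no λ ()
A ≟ᶜ C = no λ ()
B ≟ᶜ A = no λ ()
B ≟ᶜ B = yes refl
B ≟ᶜ C = no λ ()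
C ≟ᶜ A = no λ ()
C ≟ᶜ B = no λ ()
C ≟ᶜ C = yes refl

-- Definitionally the relabellings fA, fB, fC in the definition of step.
embed : Copy → Gasket → ℕ → ℕ
embed A G v = v
embed B G v = if v == ex₁ G then ex₂ G else bound G + v
embed C G v = if v == ex₁ G then ex₃ G
              else (if v == ex₂ G then embed B G (ex₃ G) else 2 * bound G + v)

mapPair : (ℕ → ℕ) → ℕ × ℕ → ℕ × ℕ
mapPair f (x , y) = f x , f y

acrossCopies : {X Y : Set} → (Copy → X → Y) → List X → List Y
acrossCopies f xs = map (f A) xs ++ map (f B) xs ++ map (f C) xs

module _ {X Y : Set} (f : Copy → X → Y) (xs : List X) where

  ∈-acrossCopies⁻ : ∀ {y} → y ∈ acrossCopies f xs → ∃[ c ] ∃[ x ] (x ∈ xs × y ≡ f c x)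
  ∈-acrossCopies⁻ y∈ with ∈-++⁻ (map (f A) xs) y∈
  ... | inj₁ y∈A = A , ∈-map⁻ (f A) y∈A
  ... | inj₂ y∈BC with ∈-++⁻ (map (f B) xs) y∈BC
  ... | inj₁ y∈B = B , ∈-map⁻ (f B) y∈B
  ... | inj₂ y∈C = C , ∈-map⁻ (f C) y∈C

  ∈-acrossCopies⁺ : ∀ c {x} → x ∈ xs → f c x ∈ acrossCopies f xs
  ∈-acrossCopies⁺ A x∈ = ∈-++⁺ˡ (∈-map⁺ (f A) x∈)
  ∈-acrossCopies⁺ B x∈ = ∈-++⁺ʳ (map (f A) xs) (∈-++⁺ˡ (∈-map⁺ (f B) x∈))
  ∈-acrossCopies⁺ C x∈ = ∈-++⁺ʳ (map (f A) xs) (∈-++⁺ʳ (map (f B) xs) (∈-map⁺ (f C) x∈))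

  length-acrossCopies : length (acrossCopies f xs) ≡ 3 * length xs
  length-acrossCopies = begin
    length (map (f A) xs ++ map (f B) xs ++ map (f C) xs)
      ≡⟨ length-++ (map (f A) xs) ⟩
    length (map (f A) xs) + length (map (f B) xs ++ map (f C) xs)
      ≡⟨ cong (length (map (f A) xs) +_) (length-++ (map (f B) xs)) ⟩
    length (map (f A) xs) + (length (map (f B) xs) + length (map (f C) xs))
      ≡⟨ cong₂ _+_ (length-map (f A) xs) (cong₂ _+_ (length-map (f B) xs) (length-map (f C) xs)) ⟩
    length xs + (length xs + length xs)
      ≡⟨ cong (λ z → length xs + (length xs + z)) (sym (+-identityʳ (length xs))) ⟩
    3 * length xs ∎
    where open ≡-Reasoning

unembed : Copy → Gasket → ℕ → ℕ
unembed A G a = a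
unembed B G a = if a == ex₂ G then ex₁ G else a ∸ bound G
unembed C G a = if a == ex₃ G then ex₁ G
                else (if a == bound G + ex₃ G then ex₂ G else a ∸ 2 * bound G)

-- Only meaningful on labels that are not shared between two copies.
copyOf : Gasket → ℕ → Copy
copyOf G a with a <? bound G | a <? 2 * bound G
... | yes _ | _     = A
... | no _  | yes _ = B
... | no _  | no _  = C

copyOf-A : ∀ G {a} → a < bound G → copyOf G a ≡ A
copyOf-A G {a} a<M with a <? bound G
... | yes _ = refl
... | no a≮M = ⊥-elim (a≮M a<M)

copyOf-B : ∀ G {a} → a ≮ bound G → a < 2 * bound G → copyOf G a ≡ B
copyOf-B G {a} a≮M a<2M with a <? bound G | a <? 2 * bound G
... | yes a<M | _ = ⊥-elim (a≮M a<M)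
... | no _ | yes _ = refl
... | no _ | no a≮2M = ⊥-elim (a≮2M a<2M)

copyOf-C : ∀ G {a} → a ≮ bound G → a ≮ 2 * bound G → copyOf G a ≡ C
copyOf-C G {a} a≮M a≮2M with a <? bound G | a <? 2 * bound G
... | yes a<M | _ = ⊥-elim (a≮M a<M)
... | no _ | yes a<2M = ⊥-elim (a≮2M a<2M)
... | no _ | no _ = refl

liftPaths : Gasket → (ℕ → ℕ → List ℕ) → ℕ → ℕ → List ℕ
liftPaths G P a b = inCopy (copyOf G a)
  where
    inCopy : Copy → List ℕ
    inCopy c = map (embed c G) (P (unembed c G a) (unembed c G b))

-- Centres that are not extreme are never glued, so copyOf recovers the copy of a lifted centre.
record ExtremeFreeCover (G : Gasket) (Sv : List ℕ) (P : ℕ → ℕ → List ℕ) : Set where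
  field
    localCover : LocalCover G Sv P
    centre≢ex₁ : ∀ {u} → u ∈ Sv → u ≢ ex₁ G
    centre≢ex₂ : ∀ {u} → u ∈ Sv → u ≢ ex₂ G
    centre≢ex₃ : ∀ {u} → u ∈ Sv → u ≢ ex₃ G

module Embedding (G : Gasket) (wl : WellLabelled G) where
  open WellLabelled wl

  private
    M  = bound G
    e₁ = ex₁ G
    e₂ = ex₂ G
    e₃ = ex₃ G
    E  = edges G

  e₁<M : e₁ < M
  e₁<M = vertex<bound ex₁∈
  e₂<M : e₂ < M
  e₂<M = vertex<bound ex₂∈
  e₃<M : e₃ < M
  e₃<M = vertex<bound ex₃∈

  embedB-e₁ : embed B G e₁ ≡ e₂
  embedB-e₁ rewrite ==-refl e₁ = refl

  embedB-shifted : ∀ {x} → x ≢ e₁ → embed B G x ≡ M + x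
  embedB-shifted x≢e₁ rewrite ≢⇒==-false x≢e₁ = refl

  embedC-e₁ : embed C G e₁ ≡ e₃
  embedC-e₁ rewrite ==-refl e₁ = refl

  embedC-e₂ : embed C G e₂ ≡ embed B G e₃
  embedC-e₂ rewrite ≢⇒==-false (ex₁≢ex₂ ∘ sym) | ==-refl e₂ = refl

  embedC-shifted : ∀ {x} → x ≢ e₁ → x ≢ e₂ → embed C G x ≡ 2 * M + x
  embedC-shifted x≢e₁ x≢e₂ rewrite ≢⇒==-false x≢e₁ | ≢⇒==-false x≢e₂ = refl

  data ViewB (x : ℕ) : Set where
    glued   : x ≡ e₁ → embed B G x ≡ e₂ → ViewB x
    shifted : x ≢ e₁ → embed B G x ≡ M + x → ViewB x

  viewB : ∀ x → ViewB x
  viewB x with x ≟ e₁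
  ... | yes refl = glued refl embedB-e₁
  ... | no x≢e₁ = shifted x≢e₁ (embedB-shifted x≢e₁)

  data ViewC (x : ℕ) : Set where
    glued₁  : x ≡ e₁ → embed C G x ≡ e₃ → ViewC x
    glued₂  : x ≡ e₂ → embed C G x ≡ M + e₃ → ViewC x
    shifted : x ≢ e₁ → x ≢ e₂ → embed C G x ≡ M + (M + x) → ViewC x

  viewC : ∀ x → ViewC x
  viewC x with x ≟ e₁ | x ≟ e₂
  ... | yes refl | _ = glued₁ refl embedC-e₁
  ... | no _ | yes refl = glued₂ refl (trans embedC-e₂ (embedB-shifted (ex₁≢ex₃ ∘ sym)))
  ... | no x≢e₁ | no x≢e₂ =
    shifted x≢e₁ x≢e₂ (trans (embedC-shifted x≢e₁ x≢e₂) (2*M+x≡M+[M+x] M x))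

  private
    via : ∀ {a b p q : ℕ} → p ≡ a → p ≡ q → q ≡ b → a ≡ b
    via p≡a p≡q q≡b = trans (sym p≡a) (trans p≡q q≡b)

    2*M≡M+M : 2 * M ≡ M + M
    2*M≡M+M = cong (M +_) (+-identityʳ M)

    cancel : ∀ {a b} → M + a ≡ M + b → a ≡ b
    cancel {a} {b} = +-cancelˡ-≡ M a b

  embed-injective : ∀ c {x y} → embed c G x ≡ embed c G y → x ≡ y
  embed-injective A eq = eq
  embed-injective B {x} {y} eq with viewB x | viewB y
  ... | glued x≡ _   | glued y≡ _   = trans x≡ (sym y≡)
  ... | glued _ p    | shifted _ q  = ⊥-elim (<M⇒≢M+ e₂<M (via p eq q))
  ... | shifted _ p  | glued _ q    = ⊥-elim (<M⇒≢M+ e₂<M (via q (sym eq) p))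
  ... | shifted _ p  | shifted _ q  = cancel (via p eq q)
  embed-injective C {x} {y} eq with viewC x | viewC y
  ... | glued₁ x≡ _     | glued₁ y≡ _     = trans x≡ (sym y≡)
  ... | glued₁ _ p      | glued₂ _ q      = ⊥-elim (<M⇒≢M+ e₃<M (via p eq q))
  ... | glued₁ _ p      | shifted _ _ q   = ⊥-elim (<M⇒≢M+ e₃<M (via p eq q))
  ... | glued₂ _ p      | glued₁ _ q      = ⊥-elim (<M⇒≢M+ e₃<M (via q (sym eq) p))
  ... | glued₂ x≡ _     | glued₂ y≡ _     = trans x≡ (sym y≡)
  ... | glued₂ _ p      | shifted _ _ q   = ⊥-elim (<M⇒≢M+ e₃<M (cancel (via p eq q)))
  ... | shifted _ _ p   | glued₁ _ q      = ⊥-elim (<M⇒≢M+ e₃<M (via q (sym eq) p))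
  ... | shifted _ _ p   | glued₂ _ q      = ⊥-elim (<M⇒≢M+ e₃<M (cancel (via q (sym eq) p)))
  ... | shifted _ _ p   | shifted _ _ q   = cancel (cancel (via p eq q))

  -- The label in copy c of the vertex that copy c shares with copy d.
  shared : Copy → Copy → ℕ
  shared A B = e₂
  shared A C = e₃
  shared B C = e₃
  shared C B = e₂
  shared _ _ = e₁

  embed-overlap : ∀ c d → c ≢ d → ∀ {u x} → u < M → x < M →
                  embed c G u ≡ embed d G x → u ≡ shared c d
  embed-overlap A A c≢d _ _ _ = ⊥-elim (c≢d refl)
  embed-overlap B B c≢d _ _ _ = ⊥-elim (c≢d refl)
  embed-overlap C C c≢d _ _ _ = ⊥-elim (c≢d refl)
  embed-overlap A B _ {u} {x} u<M _ eq with viewB x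
  ... | glued _ q   = trans eq q
  ... | shifted _ q = ⊥-elim (<M⇒≢M+ u<M (trans eq q))
  embed-overlap A C _ {u} {x} u<M _ eq with viewC x
  ... | glued₁ _ q    = trans eq q
  ... | glued₂ _ q    = ⊥-elim (<M⇒≢M+ u<M (trans eq q))
  ... | shifted _ _ q = ⊥-elim (<M⇒≢M+ u<M (trans eq q))
  embed-overlap B A _ {u} {x} _ x<M eq with viewB u
  ... | glued u≡ _  = u≡
  ... | shifted _ q = ⊥-elim (<M⇒≢M+ x<M (trans (sym eq) q))
  embed-overlap C A _ {u} {x} _ x<M eq with viewC u
  ... | glued₁ u≡ _   = u≡
  ... | glued₂ _ q    = ⊥-elim (<M⇒≢M+ x<M (trans (sym eq) q))
  ... | shifted _ _ q = ⊥-elim (<M⇒≢M+ x<M (trans (sym eq) q))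
  embed-overlap B C _ {u} {x} u<M _ eq with viewB u | viewC x
  ... | glued _ p   | glued₁ _ q    = ⊥-elim (ex₂≢ex₃ (via p eq q))
  ... | glued _ p   | glued₂ _ q    = ⊥-elim (<M⇒≢M+ e₂<M (via p eq q))
  ... | glued _ p   | shifted _ _ q = ⊥-elim (<M⇒≢M+ e₂<M (via p eq q))
  ... | shifted _ p | glued₁ _ q    = ⊥-elim (<M⇒≢M+ e₃<M (via q (sym eq) p))
  ... | shifted _ p | glued₂ _ q    = cancel (via p eq q)
  ... | shifted _ p | shifted _ _ q = ⊥-elim (<M⇒≢M+ u<M (cancel (via p eq q)))
  embed-overlap C B _ {u} {x} _ x<M eq with viewC u | viewB x
  ... | glued₁ _ p    | glued _ q   = ⊥-elim (ex₂≢ex₃ (via q (sym eq) p))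
  ... | glued₁ _ p    | shifted _ q = ⊥-elim (<M⇒≢M+ e₃<M (via p eq q))
  ... | glued₂ u≡ _   | _           = u≡
  ... | shifted _ _ p | glued _ q   = ⊥-elim (<M⇒≢M+ e₂<M (via q (sym eq) p))
  ... | shifted _ _ p | shifted _ q = ⊥-elim (<M⇒≢M+ x<M (cancel (via q (sym eq) p)))

  ∈-edges-step⁻ : ∀ {a b} → (a , b) ∈ edges (step G) →
                  ∃[ c ] ∃[ x ] ∃[ y ] ((x , y) ∈ E × a ≡ embed c G x × b ≡ embed c G y)
  ∈-edges-step⁻ ab∈ with ∈-acrossCopies⁻ (λ c → mapPair (embed c G)) E ab∈
  ... | c , (x , y) , xy∈ , refl = c , x , y , xy∈ , refl , refl

  embed-∈-edges : ∀ c {x y} → (x , y) ∈ E → (embed c G x , embed c G y) ∈ edges (step G)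
  embed-∈-edges c xy∈ = ∈-acrossCopies⁺ (λ c → mapPair (embed c G)) E c xy∈

  -- Two copies share a single vertex, so distinct vertices of copy c can only be
  -- joined by an edge of copy c itself.
  embed-∈-edges⁻ : ∀ c {u v} → u < M → v < M → u ≢ v →
                   (embed c G u , embed c G v) ∈ edges (step G) → (u , v) ∈ E
  embed-∈-edges⁻ c u<M v<M u≢v uv∈ with ∈-edges-step⁻ uv∈
  ... | d , x , y , xy∈ , u≡ , v≡ with c ≟ᶜ d | edge<bound xy∈
  ... | yes refl | _ = subst₂ (λ a b → (a , b) ∈ E)
                         (sym (embed-injective c u≡)) (sym (embed-injective c v≡)) xy∈
  ... | no c≢d | x<M , y<M =
    ⊥-elim (u≢v (trans (embed-overlap c d c≢d u<M x<M u≡)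
                       (sym (embed-overlap c d c≢d v<M y<M v≡))))

  embed-Adj : ∀ c {u v} → Adj G u v → Adj (step G) (embed c G u) (embed c G v)
  embed-Adj c (inj₁ uv∈) = inj₁ (embed-∈-edges c uv∈)
  embed-Adj c (inj₂ vu∈) = inj₂ (embed-∈-edges c vu∈)

  embed-Adj⁻ : ∀ c {u v} → u < M → v < M → u ≢ v →
               Adj (step G) (embed c G u) (embed c G v) → Adj G u v
  embed-Adj⁻ c u<M v<M u≢v (inj₁ uv∈) = inj₁ (embed-∈-edges⁻ c u<M v<M u≢v uv∈)
  embed-Adj⁻ c u<M v<M u≢v (inj₂ vu∈) = inj₂ (embed-∈-edges⁻ c v<M u<M (u≢v ∘ sym) vu∈)

  private
    notE₁ : ℕ → Bool
    notE₁ v = not (v == e₁)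
    notE₁₂ : ℕ → Bool
    notE₁₂ v = not (v == e₁) ∧ not (v == e₂)

  ∈-verts-step⁻ : ∀ {v} → v ∈ verts (step G) →
                  ∃[ c ] ∃[ x ] (x ∈ verts G × v ≡ embed c G x)
  ∈-verts-step⁻ v∈ with ∈-++⁻ (verts G) v∈
  ... | inj₁ v∈A = A , _ , v∈A , refl
  ... | inj₂ v∈BC with ∈-++⁻ (map (embed B G) (filterᵇ notE₁ (verts G))) v∈BC
  ... | inj₁ v∈B with ∈-map⁻ (embed B G) v∈B
  ...   | x , x∈ , v≡ = B , x , proj₁ (∈-filter⁻ (T? ∘ notE₁) x∈) , v≡
  ∈-verts-step⁻ v∈ | inj₂ _ | inj₂ v∈C with ∈-map⁻ (embed C G) v∈C
  ...   | x , x∈ , v≡ = C , x , proj₁ (∈-filter⁻ (T? ∘ notE₁₂) x∈) , v≡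

  embed-∈-verts : ∀ c {x} → x ∈ verts G → embed c G x ∈ verts (step G)
  embed-∈-verts A x∈ = ∈-++⁺ˡ x∈
  embed-∈-verts B {x} x∈ with viewB x
  ... | glued refl q = subst (_∈ verts (step G)) (sym q) (∈-++⁺ˡ ex₂∈)
  ... | shifted x≢e₁ _ =
    ∈-++⁺ʳ (verts G) (∈-++⁺ˡ (∈-map⁺ (embed B G) (∈-filter⁺ (T? ∘ notE₁) x∈ keep)))
    where
      keep : T (notE₁ x)
      keep rewrite ≢⇒==-false x≢e₁ = tt
  embed-∈-verts C {x} x∈ with viewC x
  ... | glued₁ refl q = subst (_∈ verts (step G)) (sym q) (∈-++⁺ˡ ex₃∈)
  ... | glued₂ refl _ = subst (_∈ verts (step G)) (sym embedC-e₂) (embed-∈-verts B ex₃∈)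
  ... | shifted x≢e₁ x≢e₂ _ =
    ∈-++⁺ʳ (verts G) (∈-++⁺ʳ (map (embed B G) (filterᵇ notE₁ (verts G)))
      (∈-map⁺ (embed C G) (∈-filter⁺ (T? ∘ notE₁₂) x∈ keep)))
    where
      keep : T (notE₁₂ x)
      keep rewrite ≢⇒==-false x≢e₁ | ≢⇒==-false x≢e₂ = tt

  private
    <M⇒<3M : ∀ {a} → a < M → a < 3 * M
    <M⇒<3M a<M = <-≤-trans a<M (m≤m+n M _)

    <M⇒M+<3M : ∀ {a} → a < M → M + a < 3 * M
    <M⇒M+<3M a<M = <-≤-trans (+-monoʳ-< M a<M) (+-monoʳ-≤ M (m≤m+n M _))

    <M⇒M+M+<3M : ∀ {a} → a < M → M + (M + a) < 3 * M
    <M⇒M+M+<3M a<M = +-monoʳ-< M (+-monoʳ-< M (subst (_ <_) (sym (+-identityʳ M)) a<M))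

  embed<3M : ∀ c {x} → x < M → embed c G x < 3 * M
  embed<3M A x<M = <M⇒<3M x<M
  embed<3M B {x} x<M with viewB x
  ... | glued _ q     = subst (_< 3 * M) (sym q) (<M⇒<3M e₂<M)
  ... | shifted _ q   = subst (_< 3 * M) (sym q) (<M⇒M+<3M x<M)
  embed<3M C {x} x<M with viewC x
  ... | glued₁ _ q    = subst (_< 3 * M) (sym q) (<M⇒<3M e₃<M)
  ... | glued₂ _ q    = subst (_< 3 * M) (sym q) (<M⇒M+<3M e₃<M)
  ... | shifted _ _ q = subst (_< 3 * M) (sym q) (<M⇒M+M+<3M x<M)

  step-wellLabelled : WellLabelled (step G)
  step-wellLabelled = record
    { vertex<bound = vertex<3M
    ; edge<bound   = edge<3M
    ; ex₁∈ = embed-∈-verts A ex₁∈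
    ; ex₂∈ = subst (_∈ verts (step G)) (embedB-shifted (ex₁≢ex₂ ∘ sym)) (embed-∈-verts B ex₂∈)
    ; ex₃∈ = subst (_∈ verts (step G)) (embedC-shifted (ex₁≢ex₃ ∘ sym) (ex₂≢ex₃ ∘ sym))
                   (embed-∈-verts C ex₃∈)
    ; ex₁≢ex₂ = <M⇒≢M+ e₁<M
    ; ex₁≢ex₃ = <M⇒≢M+ e₁<M ∘ flip trans (2*M+x≡M+[M+x] M e₃)
    ; ex₂≢ex₃ = <M⇒≢M+ e₂<M ∘ cancel ∘ flip trans (2*M+x≡M+[M+x] M e₃)
    }
    where
      vertex<3M : ∀ {v} → v ∈ verts (step G) → v < 3 * M
      vertex<3M v∈ with ∈-verts-step⁻ v∈
      ... | c , x , x∈ , refl = embed<3M c (vertex<bound x∈)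
      edge<3M : ∀ {a b} → (a , b) ∈ edges (step G) → a < 3 * M × b < 3 * M
      edge<3M ab∈ with ∈-edges-step⁻ ab∈
      ... | c , x , y , xy∈ , refl , refl =
        embed<3M c (proj₁ (edge<bound xy∈)) , embed<3M c (proj₂ (edge<bound xy∈))

  embed-Geodesic≤2 : ∀ c {u v p} → Geodesic≤2 G u v p →
                    Geodesic≤2 (step G) (embed c G u) (embed c G v) (map (embed c G) p)
  embed-Geodesic≤2 c (zeroSteps v∈) = zeroSteps (embed-∈-verts c v∈)
  embed-Geodesic≤2 c (oneStep u∈ v∈ u≢v uv) =
    oneStep (embed-∈-verts c u∈) (embed-∈-verts c v∈) (u≢v ∘ embed-injective c) (embed-Adj c uv)
  embed-Geodesic≤2 c (twoSteps u∈ v∈ u≢v ¬uv uw wv) =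
    twoSteps (embed-∈-verts c u∈) (embed-∈-verts c v∈) (u≢v ∘ embed-injective c)
             (¬uv ∘ embed-Adj⁻ c (vertex<bound u∈) (vertex<bound v∈) u≢v)
             (embed-Adj c uw) (embed-Adj c wv)

  unembed-embed : ∀ c {x} → x < M → unembed c G (embed c G x) ≡ x
  unembed-embed A _ = refl
  unembed-embed B {x} x<M with viewB x
  ... | glued refl q rewrite q | ==-refl e₂ = refl
  ... | shifted _ q rewrite q | ≢⇒==-false (<M⇒≢M+ {b = x} e₂<M ∘ sym) = m+n∸m≡n M x
  unembed-embed C {x} x<M with viewC x
  ... | glued₁ refl q rewrite q | ==-refl e₃ = refl
  ... | glued₂ refl q
    rewrite q | ≢⇒==-false (<M⇒≢M+ {b = e₃} e₃<M ∘ sym) | ==-refl (M + e₃) = refl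
  ... | shifted _ _ q
    rewrite q | ≢⇒==-false (<M⇒≢M+ {b = M + x} e₃<M ∘ sym)
          | ≢⇒==-false (<M⇒≢M+ {b = x} e₃<M ∘ sym ∘ cancel)
          | sym (2*M+x≡M+[M+x] M x) = m+n∸m≡n (2 * M) x

  shift : Copy → ℕ → ℕ
  shift A x = x
  shift B x = M + x
  shift C x = M + (M + x)

  embed-shift : ∀ c {x} → x ≢ e₁ → x ≢ e₂ → embed c G x ≡ shift c x
  embed-shift A _ _ = refl
  embed-shift B x≢e₁ _ = embedB-shifted x≢e₁
  embed-shift C {x} x≢e₁ x≢e₂ = trans (embedC-shifted x≢e₁ x≢e₂) (2*M+x≡M+[M+x] M x)

  copyOf-embed : ∀ c {x} → x < M → x ≢ e₁ → x ≢ e₂ → copyOf G (embed c G x) ≡ c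
  copyOf-embed A x<M _ _ = copyOf-A G x<M
  copyOf-embed B {x} x<M x≢e₁ x≢e₂ rewrite embed-shift B x≢e₁ x≢e₂ =
    copyOf-B G (m+n≮m M x) (subst (M + x <_) (sym 2*M≡M+M) (+-monoʳ-< M x<M))
  copyOf-embed C {x} x<M x≢e₁ x≢e₂ rewrite embed-shift C x≢e₁ x≢e₂ =
    copyOf-C G (m+n≮m M (M + x)) (subst (_≮ 2 * M) (2*M+x≡M+[M+x] M x) (m+n≮m (2 * M) x))

  liftPaths-embed : ∀ c P {u v} → u < M → u ≢ e₁ → u ≢ e₂ → v < M →
                    liftPaths G P (embed c G u) (embed c G v) ≡ map (embed c G) (P u v)
  liftPaths-embed c P {u} {v} u<M u≢e₁ u≢e₂ v<M
    rewrite copyOf-embed c u<M u≢e₁ u≢e₂ | unembed-embed c u<M | unembed-embed c v<M = refl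

  step-extremeFreeCover : ∀ {Sv P} → ExtremeFreeCover G Sv P →
                          ExtremeFreeCover (step G) (acrossCopies (λ c → embed c G) Sv) (liftPaths G P)
  step-extremeFreeCover {Sv} {P} cover = record
    { localCover = record { centres∈ = centres∈′ ; covers = covers′ }
    ; centre≢ex₁ = avoid₁
    ; centre≢ex₂ = avoid₂
    ; centre≢ex₃ = λ a∈ → avoid₃ a∈ ∘ flip trans (2*M+x≡M+[M+x] M e₃)
    }
    where
      open ExtremeFreeCover cover
      open LocalCover localCover

      Sv′ = acrossCopies (λ c → embed c G) Sv

      centre<M : ∀ {u} → u ∈ Sv → u < M
      centre<M = vertex<bound ∘ centres∈

      centres∈′ : ∀ {a} → a ∈ Sv′ → a ∈ verts (step G)
      centres∈′ a∈ with ∈-acrossCopies⁻ (λ c → embed c G) Sv a∈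
      ... | c , u , u∈ , refl = embed-∈-verts c (centres∈ u∈)

      covers′ : ∀ {a b} → (a , b) ∈ edges (step G) → ∃[ u′ ] ∃[ v′ ]
                (u′ ∈ Sv′ × Geodesic≤2 (step G) u′ v′ (liftPaths G P u′ v′)
                          × EdgeOf a b (liftPaths G P u′ v′))
      covers′ ab∈ with ∈-edges-step⁻ ab∈
      ... | c , x , y , xy∈ , refl , refl with covers xy∈
      ... | u , v , u∈ , sp , onPath =
        embed c G u , embed c G v , ∈-acrossCopies⁺ (λ c → embed c G) Sv c u∈ ,
        subst (λ p → Geodesic≤2 (step G) (embed c G u) (embed c G v) p
                     × EdgeOf (embed c G x) (embed c G y) p)
              (sym (liftPaths-embed c P (centre<M u∈) (centre≢ex₁ u∈) (centre≢ex₂ u∈)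
                                     (vertex<bound (Geodesic≤2⇒target∈ sp))))
              (embed-Geodesic≤2 c sp , EdgeOf-map (embed c G) onPath)

      centre-shift : ∀ {a} → a ∈ Sv′ → ∃[ c ] ∃[ u ] (u ∈ Sv × a ≡ shift c u)
      centre-shift a∈ with ∈-acrossCopies⁻ (λ c → embed c G) Sv a∈
      ... | c , u , u∈ , refl = c , u , u∈ , embed-shift c (centre≢ex₁ u∈) (centre≢ex₂ u∈)

      avoid₁ : ∀ {a} → a ∈ Sv′ → a ≢ e₁
      avoid₁ a∈ with centre-shift a∈
      ... | A , u , u∈ , refl = centre≢ex₁ u∈
      ... | B , u , u∈ , refl = <M⇒≢M+ e₁<M ∘ sym
      ... | C , u , u∈ , refl = <M⇒≢M+ e₁<M ∘ sym

      avoid₂ : ∀ {a} → a ∈ Sv′ → a ≢ M + e₂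
      avoid₂ a∈ with centre-shift a∈
      ... | A , u , u∈ , refl = <M⇒≢M+ (centre<M u∈)
      ... | B , u , u∈ , refl = centre≢ex₂ u∈ ∘ cancel
      ... | C , u , u∈ , refl = <M⇒≢M+ e₂<M ∘ sym ∘ cancel

      avoid₃ : ∀ {a} → a ∈ Sv′ → a ≢ M + (M + e₃)
      avoid₃ a∈ with centre-shift a∈
      ... | A , u , u∈ , refl = <M⇒≢M+ (centre<M u∈)
      ... | B , u , u∈ , refl = <M⇒≢M+ (centre<M u∈) ∘ cancel
      ... | C , u , u∈ , refl = centre≢ex₃ u∈ ∘ cancel ∘ cancel

Sier-wellLabelled : ∀ k → WellLabelled (Sier k)
Sier-wellLabelled zero = record
  { vertex<bound = vertex<3
  ; edge<bound   = edge<3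
  ; ex₁∈ = here refl
  ; ex₂∈ = there (here refl)
  ; ex₃∈ = there (there (here refl))
  ; ex₁≢ex₂ = λ ()
  ; ex₁≢ex₃ = λ ()
  ; ex₂≢ex₃ = λ ()
  }
  where
    vertex<3 : ∀ {v} → v ∈ verts K₃ → v < 3
    vertex<3 (here refl) = s≤s z≤n
    vertex<3 (there (here refl)) = s≤s (s≤s z≤n)
    vertex<3 (there (there (here refl))) = s≤s (s≤s (s≤s z≤n))
    edge<3 : ∀ {x y} → (x , y) ∈ edges K₃ → x < 3 × y < 3
    edge<3 (here refl) = vertex<3 (here refl) , vertex<3 (there (here refl))
    edge<3 (there (here refl)) = vertex<3 (there (here refl)) , vertex<3 (there (there (here refl)))
    edge<3 (there (there (here refl))) = vertex<3 (here refl) , vertex<3 (there (there (here refl)))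
Sier-wellLabelled (suc k) = Embedding.step-wellLabelled (Sier k) (Sier-wellLabelled k)

S₃centres : List ℕ
S₃centres = 1 ∷ 2 ∷ 10 ∷ 14 ∷ 19 ∷ 23 ∷ []

-- Each edge of S₃ together with a pair (u , v), u ∈ S₃centres, whose canonical
-- path contains it.
S₃witnesses : List ((ℕ × ℕ) × (ℕ × ℕ))
S₃witnesses =
  ((0 , 1) , (1 , 0)) ∷ ((1 , 2) , (1 , 2)) ∷ ((0 , 2) , (2 , 0)) ∷
  ((1 , 4) , (1 , 4)) ∷ ((4 , 5) , (10 , 5)) ∷ ((1 , 5) , (1 , 5)) ∷
  ((2 , 5) , (2 , 5)) ∷ ((5 , 8) , (19 , 5)) ∷ ((2 , 8) , (1 , 8)) ∷
  ((4 , 10) , (1 , 10)) ∷ ((10 , 11) , (10 , 11)) ∷ ((4 , 11) , (1 , 11)) ∷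
  ((10 , 13) , (10 , 13)) ∷ ((13 , 14) , (14 , 13)) ∷ ((10 , 14) , (10 , 14)) ∷
  ((11 , 14) , (14 , 11)) ∷ ((14 , 17) , (14 , 17)) ∷ ((11 , 17) , (10 , 17)) ∷
  ((8 , 19) , (2 , 19)) ∷ ((19 , 20) , (19 , 20)) ∷ ((8 , 20) , (2 , 20)) ∷
  ((19 , 17) , (14 , 19)) ∷ ((17 , 23) , (14 , 23)) ∷ ((19 , 23) , (19 , 23)) ∷
  ((20 , 23) , (23 , 20)) ∷ ((23 , 26) , (23 , 26)) ∷ ((20 , 26) , (19 , 26)) ∷ []

WitnessFor : (ℕ × ℕ) × (ℕ × ℕ) → Set
WitnessFor ((x , y) , (u , v)) =
  u ∈ S₃centres × Geodesic≤2 (Sier 2) u v (canonicalPath (Sier 2) u v)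
                × EdgeOf x y (canonicalPath (Sier 2) u v)

witnessFor? : ∀ w → Dec (WitnessFor w)
witnessFor? ((x , y) , (u , v)) = (u ∈? S₃centres) ×-dec geodesic≤2? _ _ _ _ ×-dec edgeOf? _ _ _

S₃witnesses-valid : All WitnessFor S₃witnesses
S₃witnesses-valid = toWitness {a? = all? witnessFor? S₃witnesses} _

S₃witnesses-complete : All (_∈ map proj₁ S₃witnesses) (edges (Sier 2))
S₃witnesses-complete = toWitness {a? = all? (_∈ₑ? map proj₁ S₃witnesses) (edges (Sier 2))} _

S₃-extremeFreeCover : ExtremeFreeCover (Sier 2) S₃centres (canonicalPath (Sier 2))
S₃-extremeFreeCover = record
  { localCover = record
    { centres∈ = All.lookup (toWitness {a? = all? (_∈? verts (Sier 2)) S₃centres} _)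
    ; covers = covers
    }
  ; centre≢ex₁ = All.lookup (toWitness {a? = all? (λ u → ¬? (u ≟ ex₁ (Sier 2))) S₃centres} _)
  ; centre≢ex₂ = All.lookup (toWitness {a? = all? (λ u → ¬? (u ≟ ex₂ (Sier 2))) S₃centres} _)
  ; centre≢ex₃ = All.lookup (toWitness {a? = all? (λ u → ¬? (u ≟ ex₃ (Sier 2))) S₃centres} _)
  }
  where
    covers : ∀ {x y} → (x , y) ∈ edges (Sier 2) → ∃[ u ] ∃[ v ]
             (u ∈ S₃centres × Geodesic≤2 (Sier 2) u v (canonicalPath (Sier 2) u v)
              × EdgeOf x y (canonicalPath (Sier 2) u v))
    covers xy∈ = fromEntry (∈-map⁻ proj₁ (All.lookup S₃witnesses-complete xy∈))
      where
        fromEntry : ∀ {e} → ∃[ w ] (w ∈ S₃witnesses × e ≡ proj₁ w) → ∃[ u ] ∃[ v ]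
                    (u ∈ S₃centres × Geodesic≤2 (Sier 2) u v (canonicalPath (Sier 2) u v)
                     × EdgeOf (proj₁ e) (proj₂ e) (canonicalPath (Sier 2) u v))
        fromEntry ((_ , (u , v)) , w∈ , refl) = u , v , All.lookup S₃witnesses-valid w∈

HasExtremeFreeCover : Gasket → ℕ → Set
HasExtremeFreeCover G k = ∃[ Sv ] ∃[ P ] (ExtremeFreeCover G Sv P × length Sv ≡ k)

Sier-extremeFreeCover : ∀ m → HasExtremeFreeCover (Sier (2 + m)) (6 * 3 ^ m)
Sier-extremeFreeCover zero = S₃centres , canonicalPath (Sier 2) , S₃-extremeFreeCover , refl
Sier-extremeFreeCover (suc m) with Sier-extremeFreeCover m
... | Sv , P , cover , |Sv|≡ =
  acrossCopies (λ c → embed c G) Sv , liftPaths G P , step-extremeFreeCover cover , |Sv′|≡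
  where
    G = Sier (2 + m)
    open Embedding G (Sier-wellLabelled (2 + m))
    |Sv′|≡ : length (acrossCopies (λ c → embed c G) Sv) ≡ 6 * 3 ^ suc m
    |Sv′|≡ = begin
      length (acrossCopies (λ c → embed c G) Sv) ≡⟨ length-acrossCopies (λ c → embed c G) Sv ⟩
      3 * length Sv                               ≡⟨ cong (3 *_) |Sv|≡ ⟩
      3 * (6 * 3 ^ m)                             ≡⟨ sym (*-assoc 3 6 (3 ^ m)) ⟩
      18 * 3 ^ m                                  ≡⟨ *-assoc 6 3 (3 ^ m) ⟩
      6 * 3 ^ suc m                               ∎
      where open ≡-Reasoning

mainTheorem17 : (n : ℕ) → 3 ≤ n → SSPC2U≤ (S n) (6 * 3 ^ (n ∸ 3))
mainTheorem17 (suc (suc (suc m))) (s≤s (s≤s (s≤s _))) with Sier-extremeFreeCover m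
... | Sv , P , cover , |Sv|≡ =
  Sv , LocalCover⇒Is2SSPUCover (ExtremeFreeCover.localCover cover) , ≤-reflexive |Sv|≡
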